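{- Let $p$ be a prime and let $\theta\in\mathbb{F}_p((X^{ -1}))$ be a counterexample to the $X$-adic Littlewood conjecture over $\mathbb{F}_p$, and let $D(\theta)\in\mathbb{N}_0$ be such that for every $r\geq0$ all partial quotients $A^{(r)}_j$, $j\geq1$, of the continued fraction expansion of $\langle X^r\theta\rangle$ satisfy $\deg(A^{(r)}_j)\leq D(\theta)+1$. Then for every $m>D(\theta)$ the digital point set $(\boldsymbol{x}_n)_{0\leq n<p^m}$ over $\mathbb{F}_p$ generated by $I^{(m)}$, $H^{(m)}(\theta)$ and $J^{(m)}$ is $(D(\theta)+3)$-admissible, i.e. $$\min_{0\leq k<n<p^m}\|\boldsymbol{x}_k\ominus\boldsymbol{x}_n\|_p>p^{ -m-D(\theta)-3}.$$
   Context: For $\theta=\sum_{i=j}^\infty a_iX^{ -i}$ with $a_j\neq0$: $|\theta|=2^{ -j}$, $\langle\theta\rangle=\sum_{i\geq\max\{1,j\}}a_iX^{ -i}$, $\|\theta\|=|\langle\theta\rangle|$; counterexample means $\inf_{r\geq0,\ Q\in\mathbb{F}_p[X]\setminus\{0\}}|Q|\cdot\|X^rQ\theta\|>0$. Matrices: $I^{(m)}$ = first $m$ columns of the $\mathbb{N}\times\mathbb{N}_0$ unit matrix; $H^{(m)}(\theta)$ = first $m$ columns of the Hankel matrix with row $k\geq1$ equal to $(a_k,a_{k+1},\dots)$ (where $a_1=\cdots=a_{j-1}=0$ if $j>1$); $J^{(m)}$ = $\mathbb{N}\times m$ upper antidiagonal matrix (row $k\leq m$ has a single $1$ in column $m-k+1$,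 rows $k>m$ are zero). Digital point set: for $0\leq n<p^m$ with $n=n_0+n_1p+\cdots+n_{m-1}p^{m-1}$, $\vec n=(n_0,\dots,n_{m-1})^T$, $C_i\vec n=(y^{(i)}_1,y^{(i)}_2,\dots)^T$ mod $p$, $x^{(i)}_n=\sum_{k\geq1}y^{(i)}_kp^{ -k}$, $\boldsymbol{x}_n=(x^{(1)}_n,x^{(2)}_n,x^{(3)}_n)$ with $(C_1,C_2,C_3)=(I^{(m)},H^{(m)}(\theta),J^{(m)})$. For $\boldsymbol{x}=(x^{(1)},x^{(2)},x^{(3)})$ with digit expansions $x^{(i)}=\sum_{j\geq1}x^{(i)}_jp^{ -j}$, $\|\boldsymbol{x}\|_p=p^{ -l}$ where $l=\sum_{i=1}^3\min\{j\in\mathbb{N}:x^{(i)}_j\neq0\}$ (minimum of the empty set being $\infty$, $p^{ -\infty}=0$); $\ominus$ is componentwise digitwise subtraction modulo $p$: $x\ominus y=\sum_{j\geq1}((x_j-y_j)\bmod p)p^{ -j}$. -}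

module Defs where

open import Data.Nat using (ℕ; zero; suc; _+_; _*_; _∸_; _^_; _≤_; _<_; _<ᵇ_; _%_; _/_; NonZero)
open import Data.Bool using (if_then_else_)
open import Data.Fin using (Fin; toℕ)
open import Data.Product using (Σ; ∃; _×_)
open import Relation.Nullary using (¬_)
open import Relation.Binary.PropositionalEquality using (_≡_)
open import Relation.Binary.Construct.Closure.ReflexiveTransitive using (Star)

sumBelow : ℕ → (ℕ → ℕ) → ℕ
sumBelow zero    f = 0
sumBelow (suc n) f = sumBelow n f + f n

δ₀ : ℕ → ℕ
δ₀ zero    = 1
δ₀ (suc _) = 0

module _ (p : ℕ) .{{_ : NonZero p}} where

  -- congruence modulo p / vanishing in F_p (naturals are read as residues mod p)
  _≡ₚ_ : ℕ → ℕ → Set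
  a ≡ₚ b = a % p ≡ b % p

  IsZeroₚ : ℕ → Set
  IsZeroₚ a = a % p ≡ 0

  -- A Laurent series θ ∈ F_p((X⁻¹)), written  θ = Σ_{i≥0} c i · X^(L - i).
  -- (Every Laurent series in X⁻¹ has such a representation.)
  record Laurent : Set where
    constructor laurent
    field
      L : ℕ
      c : ℕ → Fin p

  open Laurent public

  -- coefficient of X^(-k) in θ  (used for k ≥ 1, i.e. the coefficients a_k of ⟨θ⟩)
  coeff : Laurent → ℕ → ℕ
  coeff θ k = toℕ (c θ (L θ + k))

  -- A nonzero polynomial Q = Σ_{t ≤ deg} q t · X^t with nonzero leading coefficient,
  -- so |Q| = 2^deg.
  record NZPoly : Set where
    constructor nzpoly
    field
      deg  : ℕ
      q    : ℕ → Fin p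
      lead : ¬ (toℕ (q deg) ≡ 0)

  open NZPoly public

  -- coefficient of X^(-k) in X^r · Q · θ
  coeffXrQθ : ℕ → NZPoly → Laurent → ℕ → ℕ
  coeffXrQθ r Q θ k = sumBelow (suc (deg Q)) (λ t → toℕ (q Q t) * toℕ (c θ (L θ + k + r + t)))

  -- For a fractional series φ = Σ_{k≥1} φ k X^(-k) this says ‖φ‖ = |φ| = 2^(-d);
  -- for a digit sequence it says the first nonzero digit is at position d.
  FirstNonzero : (ℕ → ℕ) → ℕ → Set
  FirstNonzero f d = (1 ≤ d) × (¬ IsZeroₚ (f d)) × (∀ k → 1 ≤ k → k < d → IsZeroₚ (f k))

  -- θ is a counterexample to the X-adic Littlewood conjecture:
  --   inf_{r ≥ 0, Q ≠ 0} |Q| · ‖X^r Q θ‖ > 0.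
  -- All values are 0 or powers of 2, so this infimum is positive iff for some K
  -- every value is ≥ 2^(-K), i.e. ⟨X^r Q θ⟩ has a nonzero coefficient of X^(-k)
  -- for some 1 ≤ k ≤ deg Q + K.
  IsCounterexample : Laurent → Set
  IsCounterexample θ =
    ∃ λ (K : ℕ) → ∀ (r : ℕ) (Q : NZPoly) →
      ∃ λ (k : ℕ) → (1 ≤ k) × (k ≤ deg Q + K) × (¬ IsZeroₚ (coeffXrQθ r Q θ k))

  -- ⟨X^r θ⟩ as a fractional series (coefficient of X^(-k), k ≥ 1)
  fracXr : Laurent → ℕ → ℕ → ℕ
  fracXr θ r k = coeff θ (r + k)

  -- One continued fraction step  φ ↦ ψ = ⟨1/φ⟩  for a nonzero fractional series φ.
  -- If φ = X^(-d) u with u = Σ_{i≥0} φ(d+i) X^(-i), u₀ ≠ 0, then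
  -- 1/φ = X^d · b with b = u⁻¹ = Σ_{n≥0} b n X^(-n) (i.e. u·b = 1), the partial
  -- quotient [1/φ] has degree d, and ψ has coefficient b (d + k) at X^(-k).
  CFStep : (ℕ → ℕ) → (ℕ → ℕ) → Set
  CFStep φ ψ =
    Σ ℕ λ d → FirstNonzero φ d ×
      Σ (ℕ → ℕ) λ b →
        (∀ n → sumBelow (suc n) (λ i → φ (d + i) * b (n ∸ i)) ≡ₚ δ₀ n) ×
        (∀ k → 1 ≤ k → ψ k ≡ₚ b (d + k))

  -- For every r ≥ 0, all partial quotients A^(r)_j (j ≥ 1) of ⟨X^r θ⟩ have degree ≤ D + 1.
  -- A^(r)_j = [1/φ_{j-1}] where φ_0 = ⟨X^r θ⟩, φ_j = ⟨1/φ_{j-1}⟩ (defined while φ_{j-1} ≠ 0),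
  -- and deg A^(r)_j = d when |φ_{j-1}| = 2^(-d).
  PartialQuotientsBounded : Laurent → ℕ → Set
  PartialQuotientsBounded θ D =
    ∀ (r : ℕ) (ψ : ℕ → ℕ) → Star CFStep (fracXr θ r) ψ →
      ∀ (d : ℕ) → FirstNonzero ψ d → d ≤ suc D

  digit : ℕ → ℕ → ℕ
  digit n zero    = n % p
  digit n (suc l) = digit (n / p) l

  -- digits y_k (k ≥ 1) of the coordinates of x_n, for C = I^(m), H^(m)(θ), J^(m)
  yI : ℕ → ℕ → ℕ → ℕ
  yI m n zero    = 0
  yI m n (suc k) = if k <ᵇ m then digit n k else 0

  yH : Laurent → ℕ → ℕ → ℕ → ℕ
  yH θ m n k = sumBelow m (λ l → coeff θ (k + l) * digit n l) % p

  yJ : ℕ → ℕ → ℕ → ℕ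
  yJ m n zero    = 0
  yJ m n (suc k) = if k <ᵇ m then digit n (m ∸ suc k) else 0

  _⊖_ : (ℕ → ℕ) → (ℕ → ℕ) → ℕ → ℕ
  (x ⊖ y) j = (x j + (p ∸ y j)) % p

  -- ‖x_k ⊖ x_n‖_p = p^(-l) with l = l₁ + l₂ + l₃; it exceeds p^(-m-t) iff all three
  -- coordinate differences are nonzero and l < m + t.
  NormGreater : Laurent → ℕ → ℕ → ℕ → ℕ → Set
  NormGreater θ m t k n =
    ∃ λ l₁ → ∃ λ l₂ → ∃ λ l₃ →
      FirstNonzero (yI m k ⊖ yI m n) l₁ ×
      FirstNonzero (yH θ m k ⊖ yH θ m n) l₂ ×
      FirstNonzero (yJ m k ⊖ yJ m n) l₃ ×
      (l₁ + l₂ + l₃ < m + t)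

  Admissible : Laurent → ℕ → ℕ → Set
  Admissible θ m t = ∀ (k n : ℕ) → k < n → n < p ^ m → NormGreater θ m t k n

-- Let v be the digitwise difference of k and n, a and b the least and greatest indices
-- with v ≠ 0. The I- and J-coordinates of x_k ⊖ x_n have their first nonzero digits at
-- a + 1 and m − b, and digit j of the H-coordinate vanishes iff the coefficient of X^(-j)
-- in ⟨X^a Q θ⟩ does, where Q = Σ_t v (a + t) X^t has degree e = b − a. This series is nonzero since θ
-- is a counterexample, and its order M is at most e + D + 1: for any φ reachable from some
-- ⟨X^r θ⟩ by continued fraction steps, of order d ≤ D + 1, either e < d and then M ≤ d − e,
-- or Q φ = P + ⟨Q φ⟩ with deg P = e − d, and multiplying by 1/φ = A + ψ shows that ⟨P ψ⟩
-- has order M − d, so induction on the degree applies. Hence the exponent of the norm is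
-- (a + 1) + M + (m − b) ≤ m + D + 2.

module Submission where

open import Defs
open import Data.Bool.Properties using (T-≡)
open import Data.Fin using (toℕ; fromℕ<)
open import Data.Fin.Properties using (toℕ-fromℕ<)
open import Data.Nat using (ℕ; zero; suc; pred; _+_; _*_; _∸_; _^_; _≤_; _<_; _%_; _/_; NonZero; z≤n; s≤s; _≟_; _≤?_; _<?_; nonTrivial⇒n>1; ≢-nonZero; >-nonZero⁻¹)
open import Data.Nat.Properties
open import Data.Nat.DivMod
open import Data.Nat.Divisibility using (_∣_; _∣0; m%n≡0⇒n∣m; n∣m⇒m%n≡0; ∣m∣n⇒∣m+n; ∣m+n∣m⇒∣n; ∣m⇒∣m*n; ∣n⇒∣m*n)
open import Data.Nat.Coprimality using (prime⇒coprime; coprime-Bézout)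
open import Data.Nat.GCD using (module Bézout)
open import Data.Nat.Induction using (<-wellFounded)
open import Data.Nat.Primality using (Prime; euclidsLemma; prime⇒nonTrivial)
open import Data.Nat.Tactic.RingSolver using (solve-∀)
open import Data.Product using (∃; _×_; _,_; proj₁; proj₂)
open import Data.Sum using (inj₁; inj₂)
open import Function using (_∘_; _⇔_; mk⇔; Equivalence)
open import Function.Construct.Composition using (_⇔-∘_)
open import Function.Construct.Symmetry using (⇔-sym)
open import Induction.WellFounded using (Acc; acc)
open import Relation.Nullary using (¬_; Dec; yes; no; contradiction)
open import Relation.Binary.PropositionalEquality
open import Relation.Binary.Construct.Closure.ReflexiveTransitive using (Star; ε; _◅_; _◅◅_)

sumBelow-cong : ∀ n {f g : ℕ → ℕ} → (∀ i → i < n → f i ≡ g i) → sumBelow n f ≡ sumBelow n g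
sumBelow-cong zero    f≡g = refl
sumBelow-cong (suc n) f≡g =
  cong₂ _+_ (sumBelow-cong n (λ i i<n → f≡g i (m<n⇒m<1+n i<n))) (f≡g n ≤-refl)

sumBelow-zero : ∀ n {f : ℕ → ℕ} → (∀ i → i < n → f i ≡ 0) → sumBelow n f ≡ 0
sumBelow-zero zero    f≡0 = refl
sumBelow-zero (suc n) f≡0 =
  cong₂ _+_ (sumBelow-zero n (λ i i<n → f≡0 i (m<n⇒m<1+n i<n))) (f≡0 n ≤-refl)

sumBelow-+ : ∀ m n (f : ℕ → ℕ) → sumBelow (m + n) f ≡ sumBelow m f + sumBelow n (λ i → f (m + i))
sumBelow-+ m zero    f = trans (cong (λ k → sumBelow k f) (+-identityʳ m)) (sym (+-identityʳ _))
sumBelow-+ m (suc n) f = begin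
  sumBelow (m + suc n) f                                        ≡⟨ cong (λ k → sumBelow k f) (+-suc m n) ⟩
  sumBelow (m + n) f + f (m + n)                                ≡⟨ cong (_+ f (m + n)) (sumBelow-+ m n f) ⟩
  sumBelow m f + sumBelow n (λ i → f (m + i)) + f (m + n)       ≡⟨ +-assoc (sumBelow m f) _ _ ⟩
  sumBelow m f + sumBelow (suc n) (λ i → f (m + i))             ∎
  where open ≡-Reasoning

sumBelow-suc : ∀ n (f : ℕ → ℕ) → sumBelow (suc n) f ≡ f 0 + sumBelow n (f ∘ suc)
sumBelow-suc n f = sumBelow-+ 1 n f

sumBelow-distrib : ∀ n (f g : ℕ → ℕ) → sumBelow n (λ i → f i + g i) ≡ sumBelow n f + sumBelow n g
sumBelow-distrib zero    f g = refl
sumBelow-distrib (suc n) f g = begin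
  sumBelow n (λ i → f i + g i) + (f n + g n)   ≡⟨ cong (_+ (f n + g n)) (sumBelow-distrib n f g) ⟩
  sumBelow n f + sumBelow n g + (f n + g n)    ≡⟨ +-assoc-comm (sumBelow n f) (sumBelow n g) (f n) (g n) ⟩
  sumBelow n f + f n + (sumBelow n g + g n)    ∎
  where
  open ≡-Reasoning
  +-assoc-comm : ∀ a b c d → a + b + (c + d) ≡ a + c + (b + d)
  +-assoc-comm = solve-∀

*-distribˡ-sumBelow : ∀ n c (f : ℕ → ℕ) → c * sumBelow n f ≡ sumBelow n (λ i → c * f i)
*-distribˡ-sumBelow zero    c f = *-zeroʳ c
*-distribˡ-sumBelow (suc n) c f =
  trans (*-distribˡ-+ c (sumBelow n f) (f n)) (cong (_+ c * f n) (*-distribˡ-sumBelow n c f))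

sumBelow-swap : ∀ m n (f : ℕ → ℕ → ℕ) →
  sumBelow m (λ i → sumBelow n (f i)) ≡ sumBelow n (λ j → sumBelow m (λ i → f i j))
sumBelow-swap zero    n f = sym (sumBelow-zero n (λ _ _ → refl))
sumBelow-swap (suc m) n f =
  trans (cong (_+ sumBelow n (f m)) (sumBelow-swap m n f))
        (sym (sumBelow-distrib n (λ j → sumBelow m (λ i → f i j)) (f m)))

sumBelow-reverse : ∀ n (f : ℕ → ℕ) → sumBelow n f ≡ sumBelow n (λ i → f (n ∸ suc i))
sumBelow-reverse zero    f = refl
sumBelow-reverse (suc n) f = begin
  sumBelow n f + f n                              ≡⟨ +-comm _ (f n) ⟩
  f n + sumBelow n f                              ≡⟨ cong (f n +_) (sumBelow-reverse n f) ⟩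
  f n + sumBelow n (λ i → f (n ∸ suc i))          ≡⟨ sumBelow-suc n (λ i → f (suc n ∸ suc i)) ⟨
  sumBelow (suc n) (λ i → f (suc n ∸ suc i))      ∎
  where open ≡-Reasoning

sumBelow-bilinear : ∀ m n (q : ℕ → ℕ) (a : ℕ → ℕ → ℕ) (c : ℕ → ℕ) →
  sumBelow n (λ j → sumBelow m (λ t → q t * a t j) * c j) ≡
  sumBelow m (λ t → q t * sumBelow n (λ j → a t j * c j))
sumBelow-bilinear m n q a c = begin
  sumBelow n (λ j → sumBelow m (λ t → q t * a t j) * c j)
    ≡⟨ sumBelow-cong n (λ j _ → *-comm _ (c j)) ⟩
  sumBelow n (λ j → c j * sumBelow m (λ t → q t * a t j))
    ≡⟨ sumBelow-cong n (λ j _ → *-distribˡ-sumBelow m (c j) _) ⟩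
  sumBelow n (λ j → sumBelow m (λ t → c j * (q t * a t j)))
    ≡⟨ sumBelow-swap m n _ ⟨
  sumBelow m (λ t → sumBelow n (λ j → c j * (q t * a t j)))
    ≡⟨ sumBelow-cong m (λ t _ → sumBelow-cong n (λ j _ → rearrange (c j) (q t) (a t j))) ⟩
  sumBelow m (λ t → sumBelow n (λ j → q t * (a t j * c j)))
    ≡⟨ sumBelow-cong m (λ t _ → *-distribˡ-sumBelow n (q t) _) ⟨
  sumBelow m (λ t → q t * sumBelow n (λ j → a t j * c j))  ∎
  where
  open ≡-Reasoning
  rearrange : ∀ x y z → x * (y * z) ≡ y * (z * x)
  rearrange = solve-∀

-- For Q = Σ_{t ≤ e} q t X^t and a fractional series φ = Σ_{i ≥ 1} φ i X^(-i):
-- fracPart e q φ i is the coefficient of X^(-i) (i ≥ 1) in Q φ, and intPart e q φ j that of X^j.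
fracPart : ℕ → (ℕ → ℕ) → (ℕ → ℕ) → ℕ → ℕ
fracPart e q φ i = sumBelow (suc e) (λ t → q t * φ (i + t))

dropConstant : (ℕ → ℕ) → ℕ → ℕ
dropConstant φ zero    = 0
dropConstant φ (suc i) = φ (suc i)

-- The terms with t ≤ j read the coefficient at t ∸ j = 0, which must count as 0.
intPart : ℕ → (ℕ → ℕ) → (ℕ → ℕ) → ℕ → ℕ
intPart e q φ j = sumBelow (suc e) (λ t → q t * dropConstant φ (t ∸ j))

split-≤ : ∀ {m n} → m ≤ n → ∃ λ o → o + m ≡ n
split-≤ {m} {n} m≤n = n ∸ m , m∸n+n≡m m≤n

module Modular (p : ℕ) .{{_ : NonZero p}} where

  IsZero : ℕ → Set
  IsZero = IsZeroₚ p

  infix 4 _≈_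
  _≈_ : ℕ → ℕ → Set
  _≈_ = _≡ₚ_ p

  IsZero? : ∀ a → Dec (IsZero a)
  IsZero? a = a % p ≟ 0

  IsZero-0 : IsZero 0
  IsZero-0 = n∣m⇒m%n≡0 0 p (p ∣0)

  IsZero-+ : ∀ {a b} → IsZero a → IsZero b → IsZero (a + b)
  IsZero-+ za zb = n∣m⇒m%n≡0 _ p (∣m∣n⇒∣m+n (m%n≡0⇒n∣m _ p za) (m%n≡0⇒n∣m _ p zb))

  IsZero-cancelˡ : ∀ {a b} → IsZero (a + b) → IsZero a → IsZero b
  IsZero-cancelˡ zab za = n∣m⇒m%n≡0 _ p (∣m+n∣m⇒∣n (m%n≡0⇒n∣m _ p zab) (m%n≡0⇒n∣m _ p za))

  IsZero-cancelʳ : ∀ {a b} → IsZero (a + b) → IsZero b → IsZero a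
  IsZero-cancelʳ {a} {b} zab = IsZero-cancelˡ (subst IsZero (+-comm a b) zab)

  IsZero-*ˡ : ∀ a {b} → IsZero b → IsZero (a * b)
  IsZero-*ˡ a zb = n∣m⇒m%n≡0 _ p (∣n⇒∣m*n a (m%n≡0⇒n∣m _ p zb))

  IsZero-*ʳ : ∀ {a} b → IsZero a → IsZero (a * b)
  IsZero-*ʳ b za = n∣m⇒m%n≡0 _ p (∣m⇒∣m*n b (m%n≡0⇒n∣m _ p za))

  IsZero-sumBelow : ∀ n {f : ℕ → ℕ} → (∀ i → i < n → IsZero (f i)) → IsZero (sumBelow n f)
  IsZero-sumBelow zero    zf = IsZero-0
  IsZero-sumBelow (suc n) zf = IsZero-+ (IsZero-sumBelow n (λ i i<n → zf i (m<n⇒m<1+n i<n))) (zf n ≤-refl)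

  sumBelow-nonzero-last : ∀ n {f : ℕ → ℕ} → (∀ i → i < n → IsZero (f i)) → ¬ IsZero (f n) →
                          ¬ IsZero (sumBelow (suc n) f)
  sumBelow-nonzero-last n zf nz zsum = nz (IsZero-cancelˡ zsum (IsZero-sumBelow n zf))

  sumBelow-nonzero⇒∃ : ∀ n {f : ℕ → ℕ} → ¬ IsZero (sumBelow n f) → ∃ λ t → t < n × ¬ IsZero (f t)
  sumBelow-nonzero⇒∃ zero    nz = contradiction IsZero-0 nz
  sumBelow-nonzero⇒∃ (suc n) {f} nz with IsZero? (f n)
  ... | no  nzₙ = n , ≤-refl , nzₙ
  ... | yes zₙ =
    let t , t<n , nzₜ = sumBelow-nonzero⇒∃ n (λ z → nz (IsZero-+ z zₙ)) in t , m<n⇒m<1+n t<n , nzₜ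

  IsZero-resp : ∀ {a b} → a ≈ b → IsZero a → IsZero b
  IsZero-resp a≈b za = trans (sym a≈b) za

  IsZero-resp⇔ : ∀ {a b} → a ≈ b → IsZero a ⇔ IsZero b
  IsZero-resp⇔ a≈b = mk⇔ (IsZero-resp a≈b) (IsZero-resp (sym a≈b))

  ≡⇒IsZero⇔ : ∀ {a b} → a ≡ b → IsZero a ⇔ IsZero b
  ≡⇒IsZero⇔ a≡b = IsZero-resp⇔ (cong (_% p) a≡b)

  +-cong : ∀ {a a′ b b′} → a ≈ a′ → b ≈ b′ → a + b ≈ a′ + b′
  +-cong {a} {a′} {b} {b′} a≈a′ b≈b′ = begin
    (a + b) % p             ≡⟨ %-distribˡ-+ a b p ⟩
    (a % p + b % p) % p     ≡⟨ cong₂ (λ x y → (x + y) % p) a≈a′ b≈b′ ⟩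
    (a′ % p + b′ % p) % p   ≡⟨ %-distribˡ-+ a′ b′ p ⟨
    (a′ + b′) % p           ∎
    where open ≡-Reasoning

  *-cong : ∀ {a a′ b b′} → a ≈ a′ → b ≈ b′ → a * b ≈ a′ * b′
  *-cong {a} {a′} {b} {b′} a≈a′ b≈b′ = begin
    (a * b) % p                 ≡⟨ %-distribˡ-* a b p ⟩
    (a % p * (b % p)) % p       ≡⟨ cong₂ (λ x y → (x * y) % p) a≈a′ b≈b′ ⟩
    (a′ % p * (b′ % p)) % p     ≡⟨ %-distribˡ-* a′ b′ p ⟨
    (a′ * b′) % p               ∎
    where open ≡-Reasoning

  sumBelow-cong-≈ : ∀ n {f g : ℕ → ℕ} → (∀ i → i < n → f i ≈ g i) → sumBelow n f ≈ sumBelow n g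
  sumBelow-cong-≈ zero    f≈g = refl
  sumBelow-cong-≈ (suc n) f≈g =
    +-cong (sumBelow-cong-≈ n (λ i i<n → f≈g i (m<n⇒m<1+n i<n))) (f≈g n ≤-refl)

  -- Adding p ∸ c % p to both sides cancels c, since c + (p ∸ c % p) is a multiple of p.
  ≈-cancelʳ : ∀ a b c → a + c ≈ b + c → a ≈ b
  ≈-cancelʳ a b c a+c≈b+c = begin
    a % p                   ≡⟨ %-remove-+ʳ a p∣c+c⁻ ⟨
    (a + (c + c⁻)) % p      ≡⟨ cong (_% p) (+-assoc a c c⁻) ⟨
    (a + c + c⁻) % p        ≡⟨ +-cong {a + c} {b + c} {c⁻} {c⁻} a+c≈b+c refl ⟩
    (b + c + c⁻) % p        ≡⟨ cong (_% p) (+-assoc b c c⁻) ⟩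
    (b + (c + c⁻)) % p      ≡⟨ %-remove-+ʳ b p∣c+c⁻ ⟩
    b % p                   ∎
    where
    open ≡-Reasoning
    c⁻ = p ∸ c % p
    p∣c+c⁻ : p ∣ c + c⁻
    p∣c+c⁻ = m%n≡0⇒n∣m _ p (begin
      (c + c⁻) % p                  ≡⟨ +-cong {c} {c % p} {c⁻} {c⁻} (sym (m%n%n≡m%n c p)) refl ⟩
      (c % p + (p ∸ c % p)) % p     ≡⟨ cong (_% p) (m+[n∸m]≡n (<⇒≤ (m%n<n c p))) ⟩
      p % p                         ≡⟨ n%n≡0 p ⟩
      0                             ∎)

  IsZero⇔≈ : ∀ {a b c} → a + b ≈ c → IsZero a ⇔ b ≈ c
  IsZero⇔≈ {a} {b} {c} a+b≈c = mk⇔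
    (λ za → trans (sym (%-remove-+ˡ b (m%n≡0⇒n∣m a p za))) a+b≈c)
    (λ b≈c → trans (≈-cancelʳ a 0 b (trans a+b≈c (sym b≈c))) IsZero-0)

  ⊖-+ : ∀ (x y : ℕ → ℕ) j → y j ≤ p → (_⊖_ p x y) j + y j ≈ x j
  ⊖-+ x y j y≤p = begin
    (x⊖y + y j) % p          ≡⟨ +-cong {x⊖y} {x j + (p ∸ y j)} {y j} {y j} (m%n%n≡m%n _ p) refl ⟩
    (x j + (p ∸ y j) + y j) % p   ≡⟨ cong (_% p) (+-assoc (x j) (p ∸ y j) (y j)) ⟩
    (x j + (p ∸ y j + y j)) % p   ≡⟨ cong (λ z → (x j + z) % p) (m∸n+n≡m y≤p) ⟩
    (x j + p) % p                 ≡⟨ [m+n]%n≡m%n (x j) p ⟩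
    x j % p                       ∎
    where
    open ≡-Reasoning
    x⊖y = (_⊖_ p x y) j

  ⊖-IsZero⇔ : ∀ (x y : ℕ → ℕ) j → y j ≤ p → IsZero ((_⊖_ p x y) j) ⇔ x j ≈ y j
  ⊖-IsZero⇔ x y j y≤p = mk⇔ (sym ∘ to) (from ∘ sym)
    where open Equivalence (IsZero⇔≈ {(_⊖_ p x y) j} {y j} {x j} (⊖-+ x y j y≤p))

  leastNonzero : ∀ n {f : ℕ → ℕ} → ¬ IsZero (f n) →
                 ∃ λ a → a ≤ n × ¬ IsZero (f a) × (∀ i → i < a → IsZero (f i))
  leastNonzero n {f} nzₙ with IsZero? (f 0)
  leastNonzero n       nzₙ | no nz₀ = 0 , z≤n , nz₀ , λ _ ()
  leastNonzero zero    nzₙ | yes z₀ = contradiction z₀ nzₙ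
  leastNonzero (suc n) nzₙ | yes z₀ with a , a≤n , nzₐ , below ← leastNonzero n nzₙ =
    suc a , s≤s a≤n , nzₐ , λ { zero _ → z₀ ; (suc i) (s≤s i<a) → below i i<a }

  greatestNonzero : ∀ {n} m {f : ℕ → ℕ} → n < m → ¬ IsZero (f n) →
                    ∃ λ b → n ≤ b × b < m × ¬ IsZero (f b) × (∀ i → b < i → i < m → IsZero (f i))
  greatestNonzero {n} (suc m) {f} n<m nzₙ with IsZero? (f m)
  ... | no nzₘ = m , ≤-pred n<m , ≤-refl , nzₘ , λ i m<i i<1+m → contradiction (≤-pred i<1+m) (<⇒≱ m<i)
  ... | yes zₘ
    with b , n≤b , b<m , b-nz , above ← greatestNonzero m (≤∧≢⇒< (≤-pred n<m) λ { refl → nzₙ zₘ }) nzₙ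
    =
    b , n≤b , m<n⇒m<1+n b<m , b-nz , above′
    where
    above′ : ∀ i → b < i → i < suc m → IsZero (f i)
    above′ i b<i i<1+m with m≤n⇒m<n∨m≡n (≤-pred i<1+m)
    ... | inj₁ i<m  = above i b<i i<m
    ... | inj₂ refl = zₘ

  firstNonzero-exists : ∀ {f : ℕ → ℕ} n → 1 ≤ n → ¬ IsZero (f n) → ∃ (FirstNonzero p f)
  firstNonzero-exists {f} (suc n) _ nzₙ with a , _ , nzₐ , below ← leastNonzero n {f ∘ suc} nzₙ =
    suc a , s≤s z≤n , nzₐ , λ { (suc i) _ (s≤s i<a) → below i i<a }

  firstNonzero-≤ : ∀ {f : ℕ → ℕ} {M k} → FirstNonzero p f M → 1 ≤ k → ¬ IsZero (f k) → M ≤ k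
  firstNonzero-≤ {M = M} {k} (_ , _ , below) 1≤k nzₖ with M ≤? k
  ... | yes M≤k = M≤k
  ... | no  M≰k = contradiction (below k 1≤k (≰⇒> M≰k)) nzₖ

  firstNonzero-resp : ∀ {f g : ℕ → ℕ} {d} → (∀ j → 1 ≤ j → j ≤ d → IsZero (f j) ⇔ IsZero (g j)) →
                      FirstNonzero p f d → FirstNonzero p g d
  firstNonzero-resp f⇔g (1≤d , nz , below) =
    1≤d , nz ∘ Equivalence.from (f⇔g _ 1≤d ≤-refl) ,
    λ k 1≤k k<d → Equivalence.to (f⇔g k 1≤k (<⇒≤ k<d)) (below k 1≤k k<d)

  firstNonzero-reverse : ∀ {m b} {f : ℕ → ℕ} → b < m → ¬ IsZero (f b) →
                         (∀ i → b < i → i < m → IsZero (f i)) → FirstNonzero p (λ j → f (m ∸ j)) (m ∸ b)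
  firstNonzero-reverse {m} {b} {f} b<m nz above =
    m<n⇒0<n∸m b<m ,
    subst (λ i → ¬ IsZero (f i)) (sym (m∸[m∸n]≡n (<⇒≤ b<m))) nz ,
    λ j 1≤j j<m∸b → above (m ∸ j)
      (subst (_< m ∸ j) (m∸[m∸n]≡n (<⇒≤ b<m)) (∸-monoʳ-< j<m∸b (m∸n≤m m b)))
      (∸-monoʳ-< 1≤j (≤-trans (<⇒≤ j<m∸b) (m∸n≤m m b)))

  sumBelow-window : ∀ {m} a e (f : ℕ → ℕ) → a + e < m → (∀ i → i < a → IsZero (f i)) →
                    (∀ i → a + e < i → i < m → IsZero (f i)) →
                    sumBelow m f ≈ sumBelow (suc e) (λ t → f (a + t))
  sumBelow-window {m} a e f a+e<m below above = begin
    sumBelow m f % p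
      ≡⟨ cong (λ n → sumBelow n f % p) (m+[n∸m]≡n a+1+e≤m) ⟨
    sumBelow (a + suc e + r) f % p
      ≡⟨ cong (_% p) (sumBelow-+ (a + suc e) r f) ⟩
    (sumBelow (a + suc e) f + rest) % p
      ≡⟨ cong (λ x → (x + rest) % p) (sumBelow-+ a (suc e) f) ⟩
    (sumBelow a f + window + rest) % p
      ≡⟨ %-remove-+ʳ _ (m%n≡0⇒n∣m _ p (IsZero-sumBelow r λ i i<r →
           above (a + suc e + i) (≤-trans (≤-reflexive (sym (+-suc a e))) (m≤m+n _ i))
                 (subst (a + suc e + i <_) (m+[n∸m]≡n a+1+e≤m) (+-monoʳ-< (a + suc e) i<r)))) ⟩
    (sumBelow a f + window) % p
      ≡⟨ %-remove-+ˡ window (m%n≡0⇒n∣m _ p (IsZero-sumBelow a below)) ⟩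
    window % p ∎
    where
    open ≡-Reasoning
    r = m ∸ (a + suc e)
    window = sumBelow (suc e) (λ t → f (a + t))
    rest = sumBelow r (λ i → f (a + suc e + i))
    a+1+e≤m : a + suc e ≤ m
    a+1+e≤m = subst (_≤ m) (sym (+-suc a e)) a+e<m

  fracPart-trailing : ∀ e n (q φ : ℕ → ℕ) k → (∀ j → e < j → IsZero (q j)) →
                      fracPart (e + n) q φ k ≈ fracPart e q φ k
  fracPart-trailing e n q φ k high = trans
    (cong (_% p) (sumBelow-+ (suc e) n (λ t → q t * φ (k + t))))
    (%-remove-+ʳ _ (m%n≡0⇒n∣m _ p
      (IsZero-sumBelow n (λ i _ → IsZero-*ʳ _ (high (suc e + i) (s≤s (m≤m+n e i)))))))

module PrimeModular (p : ℕ) .{{_ : NonZero p}} (p-prime : Prime p) where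
  open Modular p

  nonzero-* : ∀ {a b} → ¬ IsZero a → ¬ IsZero b → ¬ IsZero (a * b)
  nonzero-* {a} {b} nzₐ b-nz zab with euclidsLemma a b p-prime (m%n≡0⇒n∣m _ p zab)
  ... | inj₁ p∣a = nzₐ (n∣m⇒m%n≡0 a p p∣a)
  ... | inj₂ p∣b = b-nz (n∣m⇒m%n≡0 b p p∣b)

  1≉0 : ¬ IsZero 1
  1≉0 z = 1+n≢0 (trans (sym (m<n⇒m%n≡m (nonTrivial⇒n>1 p {{prime⇒nonTrivial p-prime}}))) z)

  ≈-by-multiples : ∀ a b k l → a + k * p ≡ b + l * p → a ≈ b
  ≈-by-multiples a b k l eq =
    trans (sym ([m+kn]%n≡m%n a k p)) (trans (cong (_% p) eq) ([m+kn]%n≡m%n b l p))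

  inverse : ∀ a → ¬ IsZero a → ∃ λ y → a * y ≈ 1
  inverse a nzₐ = invert (coprime-Bézout (prime⇒coprime p-prime {{≢-nonZero nzₐ}} (m%n<n a p)))
    where
    a′ = a % p
    p′ = p ∸ 1
    a≈a′ : a ≈ a′
    a≈a′ = sym (m%n%n≡m%n a p)
    -- Bézout gives 1 + v a′ ≡ u p: then v (p − 1) inverts a′ since a′ v ≡ −1.
    invert : Bézout.Identity 1 p a′ → ∃ λ y → a * y ≈ 1
    invert (Bézout.-+ u v eq) = v , trans (*-cong {a} {a′} {v} {v} a≈a′ refl)
      (≈-by-multiples (a′ * v) 1 0 u (trans (+-identityʳ _) (trans (*-comm a′ v) (sym eq))))
    invert (Bézout.+- u v eq) = v * p′ , trans (*-cong {a} {a′} {v * p′} {v * p′} a≈a′ refl)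
      (≈-by-multiples (a′ * (v * p′)) 1 u (v * a′) (begin
        a′ * (v * p′) + u * p            ≡⟨ cong (a′ * (v * p′) +_) eq ⟨
        a′ * (v * p′) + (1 + v * a′)     ≡⟨ identity a′ v p′ ⟩
        1 + v * a′ * suc p′              ≡⟨ cong (λ q → 1 + v * a′ * q) (m+[n∸m]≡n (>-nonZero⁻¹ p)) ⟩
        1 + v * a′ * p                   ∎))
      where
      open ≡-Reasoning
      identity : ∀ x v p′ → x * (v * p′) + (1 + v * x) ≡ 1 + v * x * suc p′
      identity = solve-∀

  -- If deg Q = e < d = ord φ, the coefficient of X^(-(d ∸ e)) in Q φ is q e · φ d ≠ 0.
  fracPart-order-≤ : ∀ e q {φ : ℕ → ℕ} {d M} → e < d → ¬ IsZero (q e) → FirstNonzero p φ d →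
                     FirstNonzero p (fracPart e q φ) M → M ≤ d
  fracPart-order-≤ e q {φ} {d} {M} e<d qₑ-nz (_ , φ-nz , φ-below) M-first = at (split-≤ e<d)
    where
    at : (∃ λ o → o + suc e ≡ d) → M ≤ d
    at (o , refl) = ≤-trans (firstNonzero-≤ M-first (s≤s z≤n) coefficient-nz) 1+o≤o+1+e
      where
      1+o≤o+1+e : suc o ≤ o + suc e
      1+o≤o+1+e = subst (suc o ≤_) (sym (+-suc o e)) (s≤s (m≤m+n o e))
      coefficient-nz : ¬ IsZero (fracPart e q φ (suc o))
      coefficient-nz = sumBelow-nonzero-last e
        (λ t t<e → IsZero-*ˡ (q t) (φ-below (suc o + t) (s≤s z≤n)
                     (≤-trans (s≤s (+-monoʳ-< o t<e)) (≤-reflexive (sym (+-suc o e))))))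
        (nonzero-* qₑ-nz (subst (λ i → ¬ IsZero (φ i)) (+-suc o e) φ-nz))

  module InverseSeries (u : ℕ → ℕ) (u₀-nonzero : ¬ IsZero (u 0)) where

    u₀⁻¹ : ℕ
    u₀⁻¹ = proj₁ (inverse (u 0) u₀-nonzero)

    -- window n i = b (n ∸ i) for i ≤ n; the new coefficient b (suc n) is
    -- −u₀⁻¹ · Σ_{i ≤ n} u (suc i) b (n ∸ i), with −1 represented by p ∸ 1.
    window : ℕ → ℕ → ℕ
    window zero    _       = u₀⁻¹
    window (suc n) zero    = u₀⁻¹ * (p ∸ 1) * sumBelow (suc n) (λ i → u (suc i) * window n i)
    window (suc n) (suc i) = window n i

    b : ℕ → ℕ
    b n = window n 0

    window≡b : ∀ {n i} → i ≤ n → window n i ≡ b (n ∸ i)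
    window≡b {n}     {zero}  _         = refl
    window≡b {suc n} {suc i} (s≤s i≤n) = window≡b i≤n

    convolution : ∀ n → sumBelow (suc n) (λ i → u i * b (n ∸ i)) ≈ δ₀ n
    convolution zero    = proj₂ (inverse (u 0) u₀-nonzero)
    convolution (suc n) = begin
      sumBelow (suc (suc n)) (λ i → u i * b (suc n ∸ i)) % p
        ≡⟨ cong (_% p) (sumBelow-suc (suc n) _) ⟩
      (u 0 * (u₀⁻¹ * p′ * S) + sumBelow (suc n) (λ i → u (suc i) * b (n ∸ i))) % p
        ≡⟨ cong (λ x → (u 0 * (u₀⁻¹ * p′ * S) + x) % p) (sumBelow-cong (suc n) window≡b′) ⟨
      (u 0 * (u₀⁻¹ * p′ * S) + S) % p
        ≡⟨ cong (λ x → (x + S) % p) (reassoc (u 0) u₀⁻¹ p′ S) ⟩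
      (u 0 * u₀⁻¹ * (p′ * S) + S) % p
        ≡⟨ +-cong {u 0 * u₀⁻¹ * (p′ * S)} {1 * (p′ * S)} {S} {S}
                  (*-cong {u 0 * u₀⁻¹} {1} {p′ * S} {p′ * S} (proj₂ (inverse (u 0) u₀-nonzero)) refl) refl ⟩
      (1 * (p′ * S) + S) % p     ≡⟨ cong (_% p) (factor p′ S) ⟩
      (suc p′ * S) % p           ≡⟨ cong (λ q → (q * S) % p) (m+[n∸m]≡n (>-nonZero⁻¹ p)) ⟩
      (p * S) % p                ≡⟨ trans (cong (_% p) (*-comm p S)) (m*n%n≡0 S p) ⟩
      0                          ≡⟨ IsZero-0 ⟨
      0 % p                      ∎
      where
      open ≡-Reasoning
      p′ = p ∸ 1
      S = sumBelow (suc n) (λ i → u (suc i) * window n i)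
      window≡b′ : ∀ i → i < suc n → u (suc i) * window n i ≡ u (suc i) * b (n ∸ i)
      window≡b′ i i≤n = cong (u (suc i) *_) (window≡b (≤-pred i≤n))
      reassoc : ∀ a y q s → a * (y * q * s) ≡ a * y * (q * s)
      reassoc = solve-∀
      factor : ∀ q s → 1 * (q * s) + s ≡ suc q * s
      factor = solve-∀

    b₀-nonzero : ¬ IsZero (b 0)
    b₀-nonzero z = 1≉0 (IsZero-resp (convolution 0) (IsZero-*ˡ (u 0) z))

module ContinuedFractionStep (p : ℕ) .{{_ : NonZero p}} (p-prime : Prime p)
                             (φ : ℕ → ℕ) (d′ : ℕ) (φ-first : FirstNonzero p φ (suc d′)) where
  open Modular p
  open PrimeModular p p-prime

  d : ℕ
  d = suc d′

  φ-below : ∀ i → 1 ≤ i → i < d → IsZero (φ i)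
  φ-below = proj₂ (proj₂ φ-first)

  φ-leading : ¬ IsZero (φ (d + 0))
  φ-leading = subst (λ i → ¬ IsZero (φ i)) (sym (+-identityʳ d)) (proj₁ (proj₂ φ-first))

  open InverseSeries (λ i → φ (d + i)) φ-leading

  ψ : ℕ → ℕ
  ψ k = b (d + k)

  cfStep : CFStep p φ ψ
  cfStep = d , φ-first , b , convolution , λ _ _ → refl

  dropConstant-below : ∀ i → i < d → IsZero (dropConstant φ i)
  dropConstant-below zero    _   = IsZero-0
  dropConstant-below (suc i) i<d = φ-below (suc i) (s≤s z≤n) i<d

  -- φ · X^d b = 1 has no fractional part: the coefficient of X^(-(suc N)).
  inverse-cancels : ∀ N → IsZero (sumBelow (suc N + d) (λ s → φ (suc s) * b (suc N + d ∸ suc s)))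
  inverse-cancels N = subst IsZero (sym split-sum) (IsZero-+
    (IsZero-sumBelow d′ (λ s s<d′ → IsZero-*ʳ _ (φ-below (suc s) (s≤s z≤n) (s≤s s<d′))))
    (IsZero-resp (sym tail≈0) IsZero-0))
    where
    F : ℕ → ℕ
    F s = φ (suc s) * b (suc N + d ∸ suc s)
    swap : ∀ N d′ → suc N + suc d′ ≡ d′ + suc (suc N)
    swap = solve-∀
    split-sum : sumBelow (suc N + d) F ≡ sumBelow d′ F + sumBelow (suc (suc N)) (λ i → F (d′ + i))
    split-sum = trans (cong (λ n → sumBelow n F) (swap N d′)) (sumBelow-+ d′ (suc (suc N)) F)
    index : ∀ i → suc N + d ∸ suc (d′ + i) ≡ suc N ∸ i
    index i = trans (cong (_∸ suc (d′ + i)) (+-comm (suc N) d)) ([m+n]∸[m+o]≡n∸o d (suc N) i)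
    tail≈0 : sumBelow (suc (suc N)) (λ i → F (d′ + i)) ≈ 0
    tail≈0 = trans (cong (_% p) (sumBelow-cong (suc (suc N)) λ i _ → cong (λ j → φ (d + i) * b j) (index i)))
                   (convolution (suc N))

  -- Q = (intPart e q φ + ⟨Q φ⟩) · X^d b, and Q has no fractional part.
  key-identity : ∀ e q k′ → let K = suc k′ + d in
    IsZero (fracPart e (intPart e q φ) ψ (suc k′) +
            sumBelow K (λ i → fracPart e q φ (suc i) * b (K ∸ suc i)))
  key-identity e q k′ = subst IsZero (sym regroup) (IsZero-sumBelow (suc e) λ t t≤e →
    IsZero-*ˡ (q t) (subst IsZero (sym (cong₂ _+_ (A≡row t t≤e) (B≡row t))) (rows t)))
    where
    open ≡-Reasoning
    k = suc k′
    K = k + d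
    A B : ℕ → ℕ
    A t = sumBelow (suc e) (λ j → dropConstant φ (t ∸ j) * ψ (k + j))
    B t = sumBelow K (λ i → φ (suc i + t) * b (K ∸ suc i))
    row : ℕ → ℕ → ℕ
    row t s = φ (suc s) * b (t + K ∸ suc s)

    regroup : fracPart e (intPart e q φ) ψ k + sumBelow K (λ i → fracPart e q φ (suc i) * b (K ∸ suc i))
            ≡ sumBelow (suc e) (λ t → q t * (A t + B t))
    regroup = begin
      _ ≡⟨ cong₂ _+_ (sumBelow-bilinear (suc e) (suc e) q (λ t j → dropConstant φ (t ∸ j)) (λ j → ψ (k + j)))
                     (sumBelow-bilinear (suc e) K q (λ t i → φ (suc i + t)) (λ i → b (K ∸ suc i))) ⟩
      _ ≡⟨ sumBelow-distrib (suc e) _ _ ⟨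
      _ ≡⟨ sumBelow-cong (suc e) (λ t _ → *-distribˡ-+ (q t) _ _) ⟨
      _ ∎

    rows : ∀ t → IsZero (sumBelow t (row t) + sumBelow K (λ i → row t (t + i)))
    rows t = subst IsZero (sumBelow-+ t K (row t))
      (subst (λ n → IsZero (sumBelow n (λ s → φ (suc s) * b (n ∸ suc s)))) (reassoc t k′ d)
             (inverse-cancels (t + k′)))
      where
      reassoc : ∀ t k′ d → suc (t + k′) + d ≡ t + (suc k′ + d)
      reassoc = solve-∀

    A≡row : ∀ t → t < suc e → A t ≡ sumBelow t (row t)
    A≡row t t≤e = begin
      sumBelow (suc e) g                                  ≡⟨ cong (λ n → sumBelow n g) (m+[n∸m]≡n (<⇒≤ t≤e)) ⟨
      sumBelow (t + (suc e ∸ t)) g                        ≡⟨ sumBelow-+ t (suc e ∸ t) g ⟩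
      sumBelow t g + sumBelow (suc e ∸ t) (λ i → g (t + i))
        ≡⟨ cong (sumBelow t g +_) (sumBelow-zero (suc e ∸ t) (λ i _ →
             cong (λ j → dropConstant φ j * ψ (k + (t + i))) (m≤n⇒m∸n≡0 (m≤m+n t i)))) ⟩
      sumBelow t g + 0                                    ≡⟨ +-identityʳ _ ⟩
      sumBelow t g                                        ≡⟨ sumBelow-reverse t g ⟩
      sumBelow t (λ s → g (t ∸ suc s))                    ≡⟨ sumBelow-cong t reindex ⟩
      sumBelow t (row t)                                  ∎
      where
      g : ℕ → ℕ
      g j = dropConstant φ (t ∸ j) * ψ (k + j)
      reindex : ∀ s → s < t → g (t ∸ suc s) ≡ row t s
      reindex s s<t = cong₂ (λ i j → dropConstant φ i * b j) (m∸[m∸n]≡n s<t) (begin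
        d + (k + (t ∸ suc s))     ≡⟨ +-comm d _ ⟩
        k + (t ∸ suc s) + d       ≡⟨ cong (_+ d) (+-comm k _) ⟩
        t ∸ suc s + k + d         ≡⟨ +-assoc (t ∸ suc s) k d ⟩
        t ∸ suc s + K             ≡⟨ +-∸-comm K s<t ⟨
        t + K ∸ suc s             ∎)

    B≡row : ∀ t → B t ≡ sumBelow K (λ i → row t (t + i))
    B≡row t = sumBelow-cong K λ i _ → cong₂ (λ x y → φ (suc x) * b y) (+-comm i t)
      (sym (trans (cong (t + K ∸_) (sym (+-suc t i))) ([m+n]∸[m+o]≡n∸o t K (suc i))))

  intPart-leading : ∀ e′ q → ¬ IsZero (q (e′ + d)) → ¬ IsZero (intPart (e′ + d) q φ e′)
  intPart-leading e′ q qₑ-nz = sumBelow-nonzero-last (e′ + d)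
    (λ t t<e → IsZero-*ˡ (q t) (dropConstant-below (t ∸ e′) (m<n+o⇒m∸n<o t e′ t<e)))
    (nonzero-* qₑ-nz (subst (λ i → ¬ IsZero (dropConstant φ i)) (sym (m+n∸m≡n e′ d))
                            (proj₁ (proj₂ φ-first))))

  intPart-above : ∀ e′ q j → e′ < j → IsZero (intPart (e′ + d) q φ j)
  intPart-above e′ q j e′<j = IsZero-sumBelow (suc (e′ + d)) λ t t≤e →
    IsZero-*ˡ (q t) (dropConstant-below (t ∸ j) (m<n+o⇒m∸n<o t j (<-≤-trans t≤e (+-monoˡ-≤ d e′<j))))

  firstNonzero-step : ∀ e′ q M′ → FirstNonzero p (fracPart (e′ + d) q φ) (suc M′ + d) →
                      FirstNonzero p (fracPart e′ (intPart (e′ + d) q φ) ψ) (suc M′)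
  firstNonzero-step e′ q M′ (_ , M-nz , M-below) = s≤s z≤n , at-M′ , below-M′
    where
    e = e′ + d
    P = intPart e q φ
    truncate : ∀ k → fracPart e P ψ k ≈ fracPart e′ P ψ k
    truncate k = fracPart-trailing e′ d P ψ k (intPart-above e′ q)

    below-M′ : ∀ k → 1 ≤ k → k < suc M′ → IsZero (fracPart e′ P ψ k)
    below-M′ (suc k′) _ k<M′ = IsZero-resp (truncate (suc k′)) (IsZero-cancelʳ (key-identity e q k′)
      (IsZero-sumBelow (suc k′ + d) λ i i<K →
        IsZero-*ʳ _ (M-below (suc i) (s≤s z≤n) (≤-<-trans i<K (+-monoˡ-< d k<M′)))))

    -- at k = M′ only the last term of the second sum survives, and it is (Q φ)_M · b 0 ≠ 0
    at-M′ : ¬ IsZero (fracPart e′ P ψ (suc M′))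
    at-M′ z = sumBelow-nonzero-last (M′ + d)
      (λ i i<K → IsZero-*ʳ _ (M-below (suc i) (s≤s z≤n) (s≤s i<K)))
      (nonzero-* M-nz (subst (λ j → ¬ IsZero (b j)) (sym (n∸n≡0 (M′ + d))) b₀-nonzero))
      (IsZero-cancelˡ (key-identity e q M′) (IsZero-resp (sym (truncate (suc M′))) z))

module PartialQuotientBound (p : ℕ) .{{_ : NonZero p}} (p-prime : Prime p) (θ : Laurent p) (D : ℕ)
                            (bounded : PartialQuotientsBounded p θ D) where
  open Modular p
  open PrimeModular p p-prime

  factor-order : ∀ e q {φ M} → FirstNonzero p (fracPart e q φ) M → ∃ λ d′ → FirstNonzero p φ (suc d′)
  factor-order e q {φ} {M} (1≤M , M-nz , _) with t , _ , nz ← sumBelow-nonzero⇒∃ (suc e) M-nz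
    with firstNonzero-exists (M + t) (≤-trans 1≤M (m≤m+n M t)) (λ z → nz (IsZero-*ˡ (q t) z))
  ... | suc d′ , φ-first = d′ , φ-first

  fracPart-order-bound : ∀ e → Acc _<_ e → ∀ q → ¬ IsZero (q e) →
                         ∀ r φ → Star (CFStep p) (fracXr p θ r) φ →
                         ∀ M → FirstNonzero p (fracPart e q φ) M → M ≤ e + suc D
  fracPart-order-bound e (acc smaller) q qₑ-nz r φ path M M-first
    with d′ , φ-first ← factor-order e q M-first
    with d≤D+1 ← bounded r φ path (suc d′) φ-first
    with suc d′ ≤? e | suc d′ <? M
  ... | no d≰e  | _       = ≤-trans (fracPart-order-≤ e q (≰⇒> d≰e) qₑ-nz φ-first M-first)
                                    (≤-trans d≤D+1 (m≤n+m (suc D) e))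
  ... | yes d≤e | no d≮M  = ≤-trans (≮⇒≥ d≮M) (≤-trans d≤e (m≤m+n e (suc D)))
  ... | yes d≤e | yes d<M with e′ , refl ← split-≤ d≤e | split-≤ (<⇒≤ d<M)
  ...   | zero   , refl = contradiction d<M (n≮n (suc d′))
  ...   | suc M″ , refl = subst (suc M″ + d ≤_) (rearrange e′ D d′) (+-monoˡ-≤ d descended)
    where
    open ContinuedFractionStep p p-prime φ d′ φ-first
    descended : suc M″ ≤ e′ + suc D
    descended = fracPart-order-bound e′ (smaller (m<m+n e′ (s≤s z≤n)))
                  (intPart (e′ + d) q φ) (intPart-leading e′ q qₑ-nz)
                  r ψ (path ◅◅ (cfStep ◅ ε)) (suc M″) (firstNonzero-step e′ q M″ M-first)
    rearrange : ∀ e′ D d′ → e′ + suc D + suc d′ ≡ e′ + suc d′ + suc D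
    rearrange = solve-∀

module Digits (p : ℕ) .{{_ : NonZero p}} where

  digit<p : ∀ n l → digit p n l < p
  digit<p n zero    = m%n<n n p
  digit<p n (suc l) = digit<p (n / p) l

  /p-< : ∀ m {x} → x < p ^ suc m → x / p < p ^ m
  /p-< m {x} x< = m<n*o⇒m/o<n (subst (x <_) (*-comm p (p ^ m)) x<)

  %-/-injective : ∀ {a c} → a % p ≡ c % p → a / p ≡ c / p → a ≡ c
  %-/-injective {a} {c} a%≡c% a/≡c/ = begin
    a                     ≡⟨ m≡m%n+[m/n]*n a p ⟩
    a % p + a / p * p     ≡⟨ cong₂ (λ x y → x + y * p) a%≡c% a/≡c/ ⟩
    c % p + c / p * p     ≡⟨ m≡m%n+[m/n]*n c p ⟨
    c                     ∎
    where open ≡-Reasoning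

  digits-differ : ∀ m {a c} → a < p ^ m → c < p ^ m → a ≢ c → ∃ λ l → l < m × digit p a l ≢ digit p c l
  digits-differ zero    a<1 c<1 a≢c = contradiction (trans (n<1⇒n≡0 a<1) (sym (n<1⇒n≡0 c<1))) a≢c
  digits-differ (suc m) {a} {c} a< c< a≢c with a % p ≟ c % p
  ... | no  a₀≢c₀ = 0 , s≤s z≤n , a₀≢c₀
  ... | yes a₀≡c₀
    with l , l<m , differ ← digits-differ m (/p-< m a<) (/p-< m c<) (a≢c ∘ %-/-injective a₀≡c₀)
    = suc l , s≤s l<m , differ

exponent-bound : ∀ a e D {M m} → a + e < m → M ≤ e + suc D → suc a + M + (m ∸ (a + e)) < m + (D + 3)
exponent-bound a e D {M} {m} a+e<m M≤ = begin-strict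
  suc a + M + r                     ≤⟨ +-monoˡ-≤ r (+-monoʳ-≤ (suc a) M≤) ⟩
  suc a + (e + suc D) + r           <⟨ n<1+n _ ⟩
  suc (suc a + (e + suc D) + r)     ≡⟨ rearrange a e D r ⟩
  a + e + r + (D + 3)               ≡⟨ cong (_+ (D + 3)) (m+[n∸m]≡n (<⇒≤ a+e<m)) ⟩
  m + (D + 3)                       ∎
  where
  open ≤-Reasoning
  r = m ∸ (a + e)
  rearrange : ∀ a e D r → suc (suc a + (e + suc D) + r) ≡ a + e + r + (D + 3)
  rearrange = solve-∀

module DifferenceCoordinates (p : ℕ) .{{_ : NonZero p}} (θ : Laurent p) (m k n : ℕ) where
  open Modular p
  open Digits p

  v : ℕ → ℕ
  v = _⊖_ p (digit p k) (digit p n)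

  v-nonzero : ∀ l → digit p k l ≢ digit p n l → ¬ IsZero (v l)
  v-nonzero l differ z = differ (begin
    digit p k l         ≡⟨ m<n⇒m%n≡m (digit<p k l) ⟨
    digit p k l % p     ≡⟨ Equivalence.to (⊖-IsZero⇔ (digit p k) (digit p n) l (<⇒≤ (digit<p n l))) z ⟩
    digit p n l % p     ≡⟨ m<n⇒m%n≡m (digit<p n l) ⟩
    digit p n l         ∎)
    where open ≡-Reasoning

  v<p : ∀ l → v l < p
  v<p l = m%n<n _ p

  yI-⊖ : ∀ {i} → i < m → (_⊖_ p (yI p m k) (yI p m n)) (suc i) ≡ v i
  yI-⊖ i<m rewrite Equivalence.to T-≡ (<⇒<ᵇ i<m) = refl

  yJ-⊖ : ∀ {i} → i < m → (_⊖_ p (yJ p m k) (yJ p m n)) (suc i) ≡ v (m ∸ suc i)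
  yJ-⊖ i<m rewrite Equivalence.to T-≡ (<⇒<ᵇ i<m) = refl

  firstNonzero-I : ∀ {a} → a < m → ¬ IsZero (v a) → (∀ i → i < a → IsZero (v i)) →
                   FirstNonzero p (_⊖_ p (yI p m k) (yI p m n)) (suc a)
  firstNonzero-I a<m nz below = firstNonzero-resp {v ∘ pred}
    (λ { (suc i) _ (s≤s i≤a) → ≡⇒IsZero⇔ (sym (yI-⊖ (≤-<-trans i≤a a<m))) })
    (s≤s z≤n , nz , λ { (suc i) _ (s≤s i<a) → below i i<a })

  firstNonzero-J : ∀ {b} → b < m → ¬ IsZero (v b) → (∀ i → b < i → i < m → IsZero (v i)) →
                   FirstNonzero p (_⊖_ p (yJ p m k) (yJ p m n)) (m ∸ b)
  firstNonzero-J {b} b<m nz above = firstNonzero-resp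
    (λ { (suc i) _ i<m∸b → ≡⇒IsZero⇔ (sym (yJ-⊖ (<-≤-trans i<m∸b (m∸n≤m m b)))) })
    (firstNonzero-reverse b<m nz above)

  hankel : (ℕ → ℕ) → ℕ → ℕ
  hankel x j = sumBelow m (λ l → coeff p θ (j + l) * x l)

  firstNonzero-H : ∀ {M} → FirstNonzero p (hankel v) M → FirstNonzero p (_⊖_ p (yH p θ m k) (yH p θ m n)) M
  firstNonzero-H = firstNonzero-resp λ j _ _ →
    ⇔-sym (⊖-IsZero⇔ (yH p θ m k) (yH p θ m n) j (<⇒≤ (m%n<n _ p)))
      ⇔-∘ (reduce ⇔-∘ IsZero⇔≈ linear)
    where
    linear : ∀ {j} → hankel v j + hankel (digit p n) j ≈ hankel (digit p k) j
    linear {j} = begin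
      (hankel v j + hankel (digit p n) j) % p
        ≡⟨ cong (_% p) (sumBelow-distrib m _ _) ⟨
      sumBelow m (λ l → θₗ l * v l + θₗ l * digit p n l) % p
        ≡⟨ cong (_% p) (sumBelow-cong m (λ l _ → *-distribˡ-+ (θₗ l) (v l) (digit p n l))) ⟨
      sumBelow m (λ l → θₗ l * (v l + digit p n l)) % p
        ≡⟨ sumBelow-cong-≈ m (λ l _ →
             *-cong {θₗ l} {θₗ l} refl (⊖-+ (digit p k) (digit p n) l (<⇒≤ (digit<p n l)))) ⟩
      hankel (digit p k) j % p ∎
      where
      open ≡-Reasoning
      θₗ : ℕ → ℕ
      θₗ l = coeff p θ (j + l)
    reduce : ∀ {j} → hankel (digit p n) j ≈ hankel (digit p k) j ⇔ yH p θ m k j ≈ yH p θ m n j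
    reduce {j} = mk⇔ (cong (_% p) ∘ sym) λ eq → sym (begin
      hankel (digit p k) j % p       ≡⟨ m%n%n≡m%n (hankel (digit p k) j) p ⟨
      hankel (digit p k) j % p % p   ≡⟨ eq ⟩
      hankel (digit p n) j % p % p   ≡⟨ m%n%n≡m%n (hankel (digit p n) j) p ⟩
      hankel (digit p n) j % p       ∎)
      where open ≡-Reasoning

  module _ (p-prime : Prime p) (D : ℕ) (bounded : PartialQuotientsBounded p θ D)
           (counterexample : IsCounterexample p θ) where
    open PartialQuotientBound p p-prime θ D bounded using (fracPart-order-bound)

    hankel-order : ∀ a e → a + e < m → (∀ i → i < a → IsZero (v i)) → ¬ IsZero (v (a + e)) →
                   (∀ i → a + e < i → i < m → IsZero (v i)) →
                   ∃ λ M → M ≤ e + suc D × FirstNonzero p (hankel v) M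
    hankel-order a e a+e<m below top above =
      let k₀ , 1≤k₀ , _ , k₀-nz = proj₂ counterexample a Q
          M , M-first = firstNonzero-exists k₀ 1≤k₀ (k₀-nz ∘ subst IsZero (sym (coeffXrQθ≡fracPart k₀)))
      in M , fracPart-order-bound e (<-wellFounded e) vₐ top a φ ε M M-first ,
         firstNonzero-resp (λ j _ _ → ⇔-sym (IsZero-resp⇔ (hankel≈fracPart j))) M-first
      where
      vₐ φ : ℕ → ℕ
      vₐ t = v (a + t)
      φ = fracXr p θ a
      hankel≈fracPart : ∀ j → hankel v j ≈ fracPart e vₐ φ j
      hankel≈fracPart j = trans
        (sumBelow-window a e (λ l → coeff p θ (j + l) * v l) a+e<m
          (λ i i<a → IsZero-*ˡ (coeff p θ (j + i)) (below i i<a))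
          (λ i a+e<i i<m → IsZero-*ˡ (coeff p θ (j + i)) (above i a+e<i i<m)))
        (cong (_% p) (sumBelow-cong (suc e) λ t _ →
          trans (*-comm _ (v (a + t))) (cong (λ i → v (a + t) * coeff p θ i) (index j a t))))
        where
        index : ∀ j a t → j + (a + t) ≡ a + (j + t)
        index = solve-∀
      Q : NZPoly p
      Q = nzpoly e (λ t → fromℕ< (v<p (a + t))) λ eq →
            top (trans (cong (_% p) (trans (sym (toℕ-fromℕ< (v<p (a + e)))) eq)) IsZero-0)
      coeffXrQθ≡fracPart : ∀ j → coeffXrQθ p a Q θ j ≡ fracPart e vₐ φ j
      coeffXrQθ≡fracPart j = sumBelow-cong (suc e) λ t _ →
        cong₂ _*_ (toℕ-fromℕ< (v<p (a + t))) (cong (λ i → toℕ (c θ i)) (index (L θ) j a t))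
        where
        index : ∀ l j a t → l + j + a + t ≡ l + (a + (j + t))
        index = solve-∀

    normGreater : ∀ a b → a ≤ b → b < m → ¬ IsZero (v a) → (∀ i → i < a → IsZero (v i)) →
                  ¬ IsZero (v b) → (∀ i → b < i → i < m → IsZero (v i)) → NormGreater p θ m (D + 3) k n
    normGreater a b a≤b b<m a-nz below b-nz above with e , refl ← m≤n⇒∃[o]m+o≡n a≤b =
      let M , M≤e+1+D , M-first = hankel-order a e b<m below b-nz above in
      suc a , M , m ∸ (a + e) ,
      firstNonzero-I (≤-<-trans a≤b b<m) a-nz below , firstNonzero-H M-first , firstNonzero-J b<m b-nz above ,
      exponent-bound a e D b<m M≤e+1+D

lemma6 : (p : ℕ) .{{_ : NonZero p}} → Prime p →
         (θ : Laurent p) → IsCounterexample p θ →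
         (D : ℕ) → PartialQuotientsBounded p θ D →
         (m : ℕ) → D < m →
         Admissible p θ m (D + 3)
lemma6 p p-prime θ counterexample D bounded m _ k n k<n n<pᵐ =
  let l , l<m , differ = digits-differ m (<-trans k<n n<pᵐ) n<pᵐ (<⇒≢ k<n)
      a , a≤l , a-nz , below = leastNonzero l (v-nonzero l differ)
      b , l≤b , b<m , b-nz , above = greatestNonzero m l<m (v-nonzero l differ)
  in normGreater p-prime D bounded counterexample a b (≤-trans a≤l l≤b) b<m a-nz below b-nz above
  where
  open Modular p
  open Digits p
  open DifferenceCoordinates p θ m k n
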